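{- For every integer $n\ge 4$, there is an injection from $P_3(0,n)$ into $U_4(0,n)$.
   Context: Durfee symbol of a partition $\lambda$. Set $\lambda_k=0$ for $k>\ell(\lambda)$. Let $d=\max\{k:\lambda_k\ge k\}$, with $d=0$ for the empty partition. Then $$\alpha=(\lambda_1-d,\ldots,\lambda_d-d)',$$ the conjugate of the partition formed by the positive entries, and $$\beta=(\lambda_{d+1},\ldots,\lambda_{\ell(\lambda)}).$$ This is written $(\alpha,\beta)_d$. Parts beyond the length are taken to be $0$. $P(0,n)$ is the set of partitions of $n$ with rank $0$, equivalently $\ell(\alpha)=\ell(\beta)$. $P_3(0,n)$ is the subset of $P(0,n)$ where $\beta_1=d$ and $\alpha_1=d>\alpha_2$. $U(0,n)$ is the set of partitions of $n$ with Durfee symbol $(\gamma,\delta)_{d'}$ such that $\ell(\gamma)-\ell(\delta)\le 0$ and $\gamma_1\le d'-1$. $U_4(0,n)$ is the subset of $U(0,n)$ where $\ell(\gamma)-\ell(\delta)=-1$ and $\delta_1=d'$. -}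

module Defs where

open import Data.Nat using (ℕ; zero; suc; _+_; _∸_; _≤_; _<_; _≤?_)
open import Data.List using (List; []; _∷_; length; map; take; drop; filter; upTo)
open import Data.Nat.ListAction using (sum)
open import Data.List.Relation.Unary.All using (All)
open import Data.List.Relation.Unary.Linked using (Linked)
open import Data.Product using (_×_)
open import Data.Bool using (if_then_else_)
open import Relation.Nullary.Decidable using (does)
open import Relation.Binary.PropositionalEquality using (_≡_)

IsPartition : ℕ → List ℕ → Set
IsPartition n λs = Linked (λ a b → b ≤ a) λs × All (λ x → 0 < x) λs × sum λs ≡ n

-- part λ k = λ_k (1-indexed), with λ_k = 0 beyond the length (and λ_0 := 0, unused).
part : List ℕ → ℕ → ℕ
part []       _             = 0
part (x ∷ xs) zero          = 0
part (x ∷ xs) (suc zero)    = x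
part (x ∷ xs) (suc (suc k)) = part xs (suc k)

durfeeFrom : ℕ → List ℕ → ℕ
durfeeFrom k []       = 0
durfeeFrom k (x ∷ xs) = if does (k ≤? x) then suc (durfeeFrom (suc k) xs) else 0

-- d = max{k : λ_k ≥ k} (for a weakly decreasing λ the set is an initial segment).
durfee : List ℕ → ℕ
durfee λs = durfeeFrom 1 λs

conjugate : List ℕ → List ℕ
conjugate μ = map (λ j → length (filter (λ x → suc j ≤? x) μ)) (upTo (part μ 1))

positives : List ℕ → List ℕ
positives = filter (λ x → 1 ≤? x)

dsα : List ℕ → List ℕ
dsα λs = conjugate (positives (map (λ x → x ∸ durfee λs) (take (durfee λs) λs)))

dsβ : List ℕ → List ℕ
dsβ λs = drop (durfee λs) λs

-- P(0,n): partitions of n with rank 0, i.e. ℓ(α) = ℓ(β).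
P0 : ℕ → List ℕ → Set
P0 n λs = IsPartition n λs × length (dsα λs) ≡ length (dsβ λs)

P3 : ℕ → List ℕ → Set
P3 n λs = P0 n λs
        × part (dsβ λs) 1 ≡ durfee λs
        × part (dsα λs) 1 ≡ durfee λs
        × part (dsα λs) 2 < durfee λs

-- U(0,n): ℓ(γ) - ℓ(δ) ≤ 0 and γ_1 ≤ d' - 1 (integer arithmetic: γ_1 + 1 ≤ d').
U0 : ℕ → List ℕ → Set
U0 n λs = IsPartition n λs
        × length (dsα λs) ≤ length (dsβ λs)
        × part (dsα λs) 1 + 1 ≤ durfee λs

U4 : ℕ → List ℕ → Set
U4 n λs = U0 n λs
        × length (dsα λs) + 1 ≡ length (dsβ λs)
        × part (dsβ λs) 1 ≡ durfee λs

-- A partition in P₃(0,n) with Durfee square d has λ_d = d + 1 and λ_{d+1} = d, every λ_i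
-- with i < d exceeds d, and λ_1 − d = ℓ(β).  Removing the last cell of row d and appending
-- a new part 1 keeps the Durfee square, turns α into γ with γ_1 = d − 1 and ℓ(γ) = ℓ(α), and
-- turns β into δ = (d, β_2, …, 1) with one more part and δ_1 = d: the result lies in U₄(0,n).
-- Dropping the last part and regrowing row d undoes the move, so it is injective.  The
-- hypothesis n ≥ 4 only excludes λ = (2,1), which is mapped to (1,1,1).
module Submission where

open import Defs
open import Data.Nat using (ℕ; zero; suc; _+_; _∸_; _≤_; _≥_; _<_; _≤?_; z≤n; s≤s; pred)
open import Data.Nat.Properties
  using (≤-refl; ≤-trans; ≤-antisym; <⇒≤; <⇒≢; <⇒≱; ≰⇒>; n≤1+n; m≤n+m; m≤m+n;
         m≤n+m∸n; +-monoʳ-≤; +-comm; +-suc; n∸n≡0; 0∸n≡0; m+n∸m≡n; m<n⇒0<n∸m; m∸n≢0⇒n<m;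
         module ≤-Reasoning)
open import Data.Nat.ListAction using (sum)
open import Data.Nat.ListAction.Properties using (sum-++)
open import Data.Nat.Tactic.RingSolver using (solve-∀)
open import Data.List using (List; []; _∷_; _++_; _∷ʳ_; length; map; take; drop; filter; upTo;
                             initLast; _∷ʳ′_)
open import Data.List.Properties
  using (length-map; length-upTo; length-++; ++-assoc; ++-identityʳ; map-++; take++drop≡id;
         length-filter; filter-all; filter-complete; filter-++)
open import Data.List.Relation.Unary.All as All using (All; []; _∷_; all?)
import Data.List.Relation.Unary.All.Properties as All
open import Data.List.Relation.Unary.Any as Any using (Any; here)
import Data.List.Relation.Unary.Any.Properties as Any
open import Data.List.Relation.Unary.Linked using (Linked; []; [-]; _∷_)
open import Data.Product using (Σ; _×_; _,_; proj₁; proj₂)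
open import Data.Sum using (inj₁; inj₂)
open import Function using (_∘_)
open import Level using (0ℓ)
open import Relation.Unary using (Pred; Decidable; ∁)
open import Relation.Nullary using (yes; no)
open import Relation.Nullary.Decidable using (dec-true; dec-false)
open import Relation.Nullary.Negation using (contradiction)
open import Relation.Binary.PropositionalEquality
  using (_≡_; refl; sym; trans; cong; subst; subst₂; module ≡-Reasoning)

modifyAt : {A : Set} → ℕ → (A → A) → List A → List A
modifyAt _       f []       = []
modifyAt zero    f (x ∷ xs) = f x ∷ xs
modifyAt (suc k) f (x ∷ xs) = x ∷ modifyAt k f xs

modifyAt-++ : ∀ {A : Set} (xs : List A) {y ys} (f : A → A) →
              modifyAt (length xs) f (xs ++ y ∷ ys) ≡ xs ++ f y ∷ ys
modifyAt-++ []       f = refl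
modifyAt-++ (x ∷ xs) f = cong (x ∷_) (modifyAt-++ xs f)

dropLast : {A : Set} → List A → List A
dropLast []           = []
dropLast (x ∷ [])     = []
dropLast (x ∷ y ∷ xs) = x ∷ dropLast (y ∷ xs)

dropLast-∷ʳ : ∀ {A : Set} (xs : List A) {x} → dropLast (xs ∷ʳ x) ≡ xs
dropLast-∷ʳ []           = refl
dropLast-∷ʳ (x ∷ [])     = refl
dropLast-∷ʳ (x ∷ y ∷ xs) = cong (x ∷_) (dropLast-∷ʳ (y ∷ xs))

length-∷ʳ : ∀ {A : Set} (xs : List A) {x} → length (xs ∷ʳ x) ≡ suc (length xs)
length-∷ʳ xs = trans (length-++ xs) (+-comm (length xs) 1)

take-suc-length-++ : ∀ {A : Set} (xs : List A) {y ys} →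
                     take (suc (length xs)) (xs ++ y ∷ ys) ≡ xs ∷ʳ y
take-suc-length-++ []       = refl
take-suc-length-++ (x ∷ xs) = cong (x ∷_) (take-suc-length-++ xs)

drop-suc-length-++ : ∀ {A : Set} (xs : List A) {y ys} → drop (suc (length xs)) (xs ++ y ∷ ys) ≡ ys
drop-suc-length-++ []       = refl
drop-suc-length-++ (x ∷ xs) = drop-suc-length-++ xs

drop≡∷⇒length-take : ∀ {A : Set} k (xs : List A) {y ys} →
                     drop k xs ≡ y ∷ ys → length (take k xs) ≡ k
drop≡∷⇒length-take zero    xs       _  = refl
drop≡∷⇒length-take (suc k) (x ∷ xs) eq = cong suc (drop≡∷⇒length-take k xs eq)

filter-shorter⇒Any∁ : ∀ {A : Set} {P : Pred A 0ℓ} (P? : Decidable P) xs →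
                      length (filter P? xs) < length xs → Any (∁ P) xs
filter-shorter⇒Any∁ P? xs shorter with all? P? xs
... | yes all = contradiction (cong length (filter-all P? all)) (<⇒≢ shorter)
... | no ¬all = All.¬All⇒Any¬ P? xs ¬all

Linked-∷ʳ⁺ : ∀ {A : Set} {R : A → A → Set} {xs y} →
             All (λ x → R x y) xs → Linked R xs → Linked R (xs ∷ʳ y)
Linked-∷ʳ⁺ []       []        = [-]
Linked-∷ʳ⁺ (r ∷ []) [-]       = r ∷ [-]
Linked-∷ʳ⁺ (_ ∷ rs) (rxy ∷ l) = rxy ∷ Linked-∷ʳ⁺ rs l

Linked-≥-lower : ∀ xs {y ys} → Linked _≥_ (xs ++ suc y ∷ y ∷ ys) → Linked _≥_ (xs ++ y ∷ y ∷ ys)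
Linked-≥-lower []            (_ ∷ l)  = ≤-refl ∷ l
Linked-≥-lower (x ∷ [])      (x≥ ∷ l) = ≤-trans (n≤1+n _) x≥ ∷ Linked-≥-lower [] l
Linked-≥-lower (x ∷ x′ ∷ xs) (x≥ ∷ l) = x≥ ∷ Linked-≥-lower (x′ ∷ xs) l

Linked-≥-before : ∀ xs {z ys} → Linked _≥_ (xs ++ z ∷ ys) → All (_≥ z) xs
Linked-≥-before []           _         = []
Linked-≥-before (x ∷ [])     (x≥z ∷ _) = x≥z ∷ []
Linked-≥-before (x ∷ y ∷ xs) (x≥y ∷ l) with Linked-≥-before (y ∷ xs) l
... | y≥z ∷ ys≥z = ≤-trans y≥z x≥y ∷ y≥z ∷ ys≥z

last-≤ : ∀ xs {z ys m} → Linked _≥_ (xs ++ z ∷ ys) → Any (_≤ m) (xs ∷ʳ z) → z ≤ m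
last-≤ xs decreasing some≤m with Any.++⁻ xs some≤m
... | inj₁ x≤m        = All.lookupWith (λ x≥z → ≤-trans x≥z) (Linked-≥-before xs decreasing) x≤m
... | inj₂ (here z≤m) = z≤m

sum-lower-∷ʳ-1 : ∀ xs y ys → sum ((xs ++ y ∷ ys) ∷ʳ 1) ≡ sum (xs ++ suc y ∷ ys)
sum-lower-∷ʳ-1 xs y ys = begin
  sum ((xs ++ y ∷ ys) ∷ʳ 1)  ≡⟨ sum-++ (xs ++ y ∷ ys) (1 ∷ []) ⟩
  sum (xs ++ y ∷ ys) + 1      ≡⟨ cong (_+ 1) (sum-++ xs (y ∷ ys)) ⟩
  sum xs + (y + sum ys) + 1   ≡⟨ reassociate (sum xs) y (sum ys) ⟩
  sum xs + (suc y + sum ys)   ≡⟨ sum-++ xs (suc y ∷ ys) ⟨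
  sum (xs ++ suc y ∷ ys)      ∎
  where
  open ≡-Reasoning
  reassociate : ∀ a b c → a + (b + c) + 1 ≡ a + (suc b + c)
  reassociate = solve-∀

lower-partition : ∀ {n} xs {y ys} → IsPartition n (xs ++ suc y ∷ y ∷ ys) →
                  IsPartition n ((xs ++ y ∷ y ∷ ys) ∷ʳ 1)
lower-partition {n} xs {y} {ys} (decreasing , positive , sum≡n) =
  Linked-∷ʳ⁺ positive′ (Linked-≥-lower xs decreasing) ,
  All.∷ʳ⁺ positive′ (s≤s z≤n) ,
  trans (sum-lower-∷ʳ-1 xs y (y ∷ ys)) sum≡n
  where
  positive′ : All (0 <_) (xs ++ y ∷ y ∷ ys)
  positive′ with All.++⁻ xs positive
  ... | xs>0 , _ ∷ y>0 ∷ ys>0 = All.++⁺ xs>0 (y>0 ∷ y>0 ∷ ys>0)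

durfeeFrom-≤ : ∀ {k x} xs → k ≤ x → durfeeFrom k (x ∷ xs) ≡ suc (durfeeFrom (suc k) xs)
durfeeFrom-≤ {k} {x} xs k≤x rewrite dec-true (k ≤? x) k≤x = refl

durfeeFrom-> : ∀ {k x} xs → x < k → durfeeFrom k (x ∷ xs) ≡ 0
durfeeFrom-> {k} {x} xs x<k rewrite dec-false (k ≤? x) (<⇒≱ x<k) = refl

durfeeFrom-corner : ∀ {m} k xs {y z ys} → length xs + k ≡ m → All (m ≤_) xs → m ≤ y → z ≤ m →
                    durfeeFrom k (xs ++ y ∷ z ∷ ys) ≡ suc (length xs)
durfeeFrom-corner k []       {z = z} {ys} refl []           k≤y z≤k =
  trans (durfeeFrom-≤ (z ∷ ys) k≤y) (cong suc (durfeeFrom-> ys (s≤s z≤k)))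
durfeeFrom-corner k (x ∷ xs) {y} {z} {ys} refl (m≤x ∷ xs≥m) m≤y z≤m =
  trans (durfeeFrom-≤ (xs ++ y ∷ z ∷ ys) (≤-trans k≤m m≤x))
        (cong suc (durfeeFrom-corner (suc k) xs (+-suc (length xs) k) xs≥m m≤y z≤m))
  where
  k≤m : k ≤ suc (length xs + k)
  k≤m = ≤-trans (m≤n+m k (length xs)) (n≤1+n _)

durfee-corner : ∀ xs {y z ys} → let d = suc (length xs) in
                All (d ≤_) xs → d ≤ y → z ≤ d → durfee (xs ++ y ∷ z ∷ ys) ≡ d
durfee-corner xs = durfeeFrom-corner 1 xs (+-comm (length xs) 1)

length-conjugate : ∀ ν → length (conjugate ν) ≡ part ν 1
length-conjugate ν = trans (length-map _ (upTo (part ν 1))) (length-upTo (part ν 1))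

conjugate-first≤length : ∀ ν → part (conjugate ν) 1 ≤ length ν
conjugate-first≤length []          = z≤n
conjugate-first≤length (zero ∷ ν)  = z≤n
conjugate-first≤length (suc m ∷ ν) = length-filter (1 ≤?_) (suc m ∷ ν)

conjugate-first≡length-positives : ∀ ν {k} →
                                   part (conjugate ν) 1 ≡ suc k → length (positives ν) ≡ suc k
conjugate-first≡length-positives (suc m ∷ ν) α₁ = α₁

positives-complete : ∀ xs {k} → length xs ≡ suc k → part (conjugate (positives xs)) 1 ≡ suc k →
                     positives xs ≡ xs
positives-complete xs {k} ℓxs α₁ =
  filter-complete (1 ≤?_) (≤-antisym (length-filter (1 ≤?_) xs) xs≤)
  where
  xs≤ : length xs ≤ length (positives xs)
  xs≤ = begin
    length xs                         ≡⟨ ℓxs ⟩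
    suc k                             ≡⟨ conjugate-first≡length-positives (positives xs) α₁ ⟨
    length (positives (positives xs)) ≤⟨ length-filter (1 ≤?_) (positives xs) ⟩
    length (positives xs)             ∎
    where open ≤-Reasoning

positives-∷ʳ-0 : ∀ xs → All (0 <_) xs → positives (xs ∷ʳ 0) ≡ xs
positives-∷ʳ-0 xs xs>0 = begin
  positives (xs ∷ʳ 0)     ≡⟨ filter-++ (1 ≤?_) xs (0 ∷ []) ⟩
  positives xs ++ []      ≡⟨ cong (_++ []) (filter-all (1 ≤?_) xs>0) ⟩
  xs ++ []                ≡⟨ ++-identityʳ xs ⟩
  xs                      ∎
  where open ≡-Reasoning

conjugate-second : ∀ ν → part (conjugate ν) 2 < length ν → Any (_< 2) ν
conjugate-second (zero ∷ ν)        _  = here (s≤s z≤n)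
conjugate-second (suc zero ∷ ν)    _  = here ≤-refl
conjugate-second (suc (suc m) ∷ ν) α₂ =
  Any.map ≰⇒> (filter-shorter⇒Any∁ (2 ≤?_) (suc (suc m) ∷ ν) α₂)

part-map-∸ : ∀ d xs → part (map (_∸ d) xs) 1 ≡ part xs 1 ∸ d
part-map-∸ d []       = sym (0∸n≡0 d)
part-map-∸ d (x ∷ xs) = refl

∸≡suc⇒≡+ : ∀ x d {k} → x ∸ d ≡ suc k → x ≡ d + suc k
∸≡suc⇒≡+ x       zero    eq = eq
∸≡suc⇒≡+ (suc x) (suc d) eq = cong suc (∸≡suc⇒≡+ x d eq)

0<∸⇒< : ∀ {x d} → 0 < x ∸ d → d < x
0<∸⇒< 0<x∸d = m∸n≢0⇒n<m (λ x∸d≡0 → <⇒≢ 0<x∸d (sym x∸d≡0))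

∸<2⇒≤suc : ∀ {x d} → x ∸ d < 2 → x ≤ suc d
∸<2⇒≤suc {x} {d} (s≤s x∸d≤1) = begin
  x             ≤⟨ m≤n+m∸n x d ⟩
  d + (x ∸ d)   ≤⟨ +-monoʳ-≤ d x∸d≤1 ⟩
  d + 1         ≡⟨ +-comm d 1 ⟩
  suc d         ∎
  where open ≤-Reasoning

-- modifyAt counts from 0, so row d is at position d − 1.
toU₄ : List ℕ → List ℕ
toU₄ λs = modifyAt (pred (durfee λs)) pred λs ∷ʳ 1

fromU₄ : List ℕ → List ℕ
fromU₄ μ = modifyAt (pred (durfee μ)) suc (dropLast μ)

-- top = (λ_1, …, λ_{d−1}) and rest = (λ_{d+2}, …); the last field says ℓ(α) = λ_1 − d = ℓ(β).
data P3Shape : List ℕ → Set where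
  p3Shape : ∀ top rest → let d = suc (length top) in
            All (d <_) top → part top 1 ≡ d + suc (length rest) →
            P3Shape (top ++ suc d ∷ d ∷ rest)

module Lowered (top rest : List ℕ) (top>d : All (suc (length top) <_) top) where
  d : ℕ
  d = suc (length top)

  λs : List ℕ
  λs = top ++ suc d ∷ d ∷ rest

  μ : List ℕ
  μ = top ++ d ∷ d ∷ rest ∷ʳ 1

  μ-assoc : (top ++ d ∷ d ∷ rest) ∷ʳ 1 ≡ μ
  μ-assoc = ++-assoc top (d ∷ d ∷ rest) (1 ∷ [])

  top≥d : All (d ≤_) top
  top≥d = All.map <⇒≤ top>d

  durfee-λs : durfee λs ≡ d
  durfee-λs = durfee-corner top top≥d (n≤1+n d) ≤-refl

  durfee-μ : durfee μ ≡ d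
  durfee-μ = durfee-corner top top≥d ≤-refl ≤-refl

  toU₄-λs : toU₄ λs ≡ μ
  toU₄-λs = begin
    modifyAt (pred (durfee λs)) pred λs ∷ʳ 1
      ≡⟨ cong (λ e → modifyAt (pred e) pred λs ∷ʳ 1) durfee-λs ⟩
    modifyAt (length top) pred λs ∷ʳ 1
      ≡⟨ cong (_∷ʳ 1) (modifyAt-++ top pred) ⟩
    (top ++ d ∷ d ∷ rest) ∷ʳ 1
      ≡⟨ μ-assoc ⟩
    μ ∎
    where open ≡-Reasoning

  fromU₄-μ : fromU₄ μ ≡ λs
  fromU₄-μ = begin
    modifyAt (pred (durfee μ)) suc (dropLast μ)
      ≡⟨ cong (λ e → modifyAt (pred e) suc (dropLast μ)) durfee-μ ⟩
    modifyAt (length top) suc (dropLast μ)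
      ≡⟨ cong (modifyAt (length top) suc ∘ dropLast) μ-assoc ⟨
    modifyAt (length top) suc (dropLast ((top ++ d ∷ d ∷ rest) ∷ʳ 1))
      ≡⟨ cong (modifyAt (length top) suc) (dropLast-∷ʳ (top ++ d ∷ d ∷ rest)) ⟩
    modifyAt (length top) suc (top ++ d ∷ d ∷ rest)
      ≡⟨ modifyAt-++ top suc ⟩
    λs ∎
    where open ≡-Reasoning

  ν : List ℕ
  ν = map (_∸ d) top

  dsα-μ : dsα μ ≡ conjugate ν
  dsα-μ = begin
    conjugate (positives (map (_∸ durfee μ) (take (durfee μ) μ)))
      ≡⟨ cong (λ e → conjugate (positives (map (_∸ e) (take e μ)))) durfee-μ ⟩
    conjugate (positives (map (_∸ d) (take d μ)))
      ≡⟨ cong (conjugate ∘ positives ∘ map (_∸ d)) (take-suc-length-++ top) ⟩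
    conjugate (positives (map (_∸ d) (top ∷ʳ d)))
      ≡⟨ cong (conjugate ∘ positives) (map-++ (_∸ d) top (d ∷ [])) ⟩
    conjugate (positives (ν ∷ʳ (d ∸ d)))
      ≡⟨ cong (λ x → conjugate (positives (ν ∷ʳ x))) (n∸n≡0 d) ⟩
    conjugate (positives (ν ∷ʳ 0))
      ≡⟨ cong conjugate (positives-∷ʳ-0 ν (All.map⁺ (All.map m<n⇒0<n∸m top>d))) ⟩
    conjugate ν ∎
    where open ≡-Reasoning

  dsβ-μ : dsβ μ ≡ d ∷ rest ∷ʳ 1
  dsβ-μ = trans (cong (λ e → drop e μ) durfee-μ) (drop-suc-length-++ top)

  U4-μ : ∀ {n} → part top 1 ≡ d + suc (length rest) → IsPartition n λs → U4 n μ
  U4-μ {n} λ₁ λs-partition = (μ-partition , ℓγ≤ℓδ , γ₁<d) , ℓγ+1≡ℓδ , δ₁≡d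
    where
    μ-partition : IsPartition n μ
    μ-partition = subst (IsPartition n) μ-assoc (lower-partition top λs-partition)

    ℓγ : length (dsα μ) ≡ suc (length rest)
    ℓγ = begin
      length (dsα μ)            ≡⟨ cong length dsα-μ ⟩
      length (conjugate ν)      ≡⟨ length-conjugate ν ⟩
      part ν 1                  ≡⟨ part-map-∸ d top ⟩
      part top 1 ∸ d            ≡⟨ cong (_∸ d) λ₁ ⟩
      d + suc (length rest) ∸ d ≡⟨ m+n∸m≡n d _ ⟩
      suc (length rest)         ∎
      where open ≡-Reasoning

    ℓδ : length (dsβ μ) ≡ suc (length rest) + 1
    ℓδ = trans (cong length dsβ-μ) (cong suc (length-++ rest))

    ℓγ≤ℓδ : length (dsα μ) ≤ length (dsβ μ)
    ℓγ≤ℓδ = subst₂ _≤_ (sym ℓγ) (sym ℓδ) (m≤m+n _ 1)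

    ℓγ+1≡ℓδ : length (dsα μ) + 1 ≡ length (dsβ μ)
    ℓγ+1≡ℓδ = trans (cong (_+ 1) ℓγ) (sym ℓδ)

    γ₁<d : part (dsα μ) 1 + 1 ≤ durfee μ
    γ₁<d = subst₂ (λ α e → part α 1 + 1 ≤ e) (sym dsα-μ) (sym durfee-μ) (begin
      part (conjugate ν) 1 + 1 ≡⟨ +-comm _ 1 ⟩
      suc (part (conjugate ν) 1) ≤⟨ s≤s (conjugate-first≤length ν) ⟩
      suc (length ν)             ≡⟨ cong suc (length-map _ top) ⟩
      d                          ∎)
      where open ≤-Reasoning

    δ₁≡d : part (dsβ μ) 1 ≡ durfee μ
    δ₁≡d = trans (cong (λ xs → part xs 1) dsβ-μ) (sym durfee-μ)

P3Shape⇒U4 : ∀ {n λs} → IsPartition n λs → P3Shape λs → U4 n (toU₄ λs)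
P3Shape⇒U4 {n} λs-partition (p3Shape top rest top>d λ₁) =
  subst (U4 n) (sym toU₄-λs) (U4-μ λ₁ λs-partition)
  where open Lowered top rest top>d

fromU₄∘toU₄ : ∀ {λs} → P3Shape λs → fromU₄ (toU₄ λs) ≡ λs
fromU₄∘toU₄ (p3Shape top rest top>d _) = trans (cong fromU₄ toU₄-λs) fromU₄-μ
  where open Lowered top rest top>d

P3Shape-intro : ∀ {n} T₀ z B → let d = suc (length T₀) in
                4 ≤ n → IsPartition n ((T₀ ∷ʳ z) ++ d ∷ B) → z ≡ suc d →
                All (d <_) T₀ → part (T₀ ∷ʳ z) 1 ≡ d + suc (length B) →
                P3Shape ((T₀ ∷ʳ z) ++ d ∷ B)
P3Shape-intro []       _ []      (s≤s (s≤s (s≤s ()))) (_ , _ , refl) refl _ _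
P3Shape-intro []       _ (_ ∷ _) _ _ refl _ ()
P3Shape-intro (x ∷ xs) z B       _ _ refl T₀>d λ₁ =
  subst P3Shape (sym (++-assoc (x ∷ xs) (z ∷ []) (_ ∷ B))) (p3Shape (x ∷ xs) B T₀>d λ₁)

P3Shape-split : ∀ {n} d T B → 4 ≤ n → length T ≡ d → IsPartition n (T ++ d ∷ B) →
                part (conjugate (positives (map (_∸ d) T))) 1 ≡ d →
                part (conjugate (positives (map (_∸ d) T))) 2 < d →
                length (conjugate (positives (map (_∸ d) T))) ≡ suc (length B) →
                P3Shape (T ++ d ∷ B)
P3Shape-split d T B n≥4 ℓT λs-partition α₁ α₂ ℓα with initLast T
P3Shape-split .0 .[] B n≥4 refl λs-partition α₁ () ℓα | []
P3Shape-split d .(T₀ ∷ʳ z) B n≥4 ℓT λs-partition α₁ α₂ ℓα | T₀ ∷ʳ′ z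
  with trans (sym (length-∷ʳ T₀)) ℓT
... | refl = P3Shape-intro T₀ z B n≥4 λs-partition z≡d+1 (proj₁ (All.∷ʳ⁻ T>d)) λ₁
  where
  T L : List ℕ
  T = T₀ ∷ʳ z
  L = map (_∸ d) T

  ℓL : length L ≡ d
  ℓL = trans (length-map _ T) (length-∷ʳ T₀)

  L-complete : positives L ≡ L
  L-complete = positives-complete L ℓL α₁

  T>d : All (d <_) T
  T>d = All.map 0<∸⇒< (All.map⁻ (subst (All (0 <_)) L-complete (All.all-filter (1 ≤?_) L)))

  some≤d+1 : Any (_≤ suc d) T
  some≤d+1 = Any.map ∸<2⇒≤suc (Any.map⁻ (conjugate-second L α₂′))
    where
    α₂′ : part (conjugate L) 2 < length L
    α₂′ = subst₂ (λ ν e → part (conjugate ν) 2 < e) L-complete (sym ℓL) α₂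

  z≡d+1 : z ≡ suc d
  z≡d+1 = ≤-antisym (last-≤ T₀ decreasing some≤d+1) (proj₂ (All.∷ʳ⁻ T>d))
    where
    decreasing : Linked _≥_ (T₀ ++ z ∷ d ∷ B)
    decreasing = subst (Linked _≥_) (++-assoc T₀ (z ∷ []) (d ∷ B)) (proj₁ λs-partition)

  λ₁ : part T 1 ≡ d + suc (length B)
  λ₁ = ∸≡suc⇒≡+ (part T 1) d (begin
    part T 1 ∸ d                     ≡⟨ part-map-∸ d T ⟨
    part L 1                         ≡⟨ length-conjugate L ⟨
    length (conjugate L)             ≡⟨ cong (length ∘ conjugate) L-complete ⟨
    length (conjugate (positives L)) ≡⟨ ℓα ⟩
    suc (length B)                   ∎)
    where open ≡-Reasoning

P3Shape-at : ∀ {n} d λs → 4 ≤ n → IsPartition n λs → part (drop d λs) 1 ≡ d →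
             part (conjugate (positives (map (_∸ d) (take d λs)))) 1 ≡ d →
             part (conjugate (positives (map (_∸ d) (take d λs)))) 2 < d →
             length (conjugate (positives (map (_∸ d) (take d λs)))) ≡ length (drop d λs) →
             P3Shape λs
P3Shape-at zero    λs n≥4 λs-partition β₁ α₁ () ℓα
P3Shape-at (suc k) λs n≥4 λs-partition β₁ α₁ α₂ ℓα with drop (suc k) λs in drop≡
P3Shape-at (suc k) λs n≥4 λs-partition () α₁ α₂ ℓα | []
P3Shape-at (suc k) λs n≥4 λs-partition refl α₁ α₂ ℓα | .(suc k) ∷ B =
  subst P3Shape (sym λs≡)
    (P3Shape-split (suc k) (take (suc k) λs) B n≥4 (drop≡∷⇒length-take (suc k) λs drop≡)
                   (subst (IsPartition _) λs≡ λs-partition) α₁ α₂ ℓα)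
  where
  λs≡ : λs ≡ take (suc k) λs ++ suc k ∷ B
  λs≡ = trans (sym (take++drop≡id (suc k) λs)) (cong (take (suc k) λs ++_) drop≡)

P3⇒P3Shape : ∀ {n λs} → 4 ≤ n → P3 n λs → P3Shape λs
P3⇒P3Shape {λs = λs} n≥4 ((λs-partition , ℓα≡ℓβ) , β₁≡d , α₁≡d , α₂<d) =
  P3Shape-at (durfee λs) λs n≥4 λs-partition β₁≡d α₁≡d α₂<d ℓα≡ℓβ

lemma4p5 : (n : ℕ) → 4 ≤ n →
    Σ (List ℕ → List ℕ) (λ f →
      ((p : List ℕ) → P3 n p → U4 n (f p))
      × ((p q : List ℕ) → P3 n p → P3 n q → f p ≡ f q → p ≡ q))
lemma4p5 n n≥4 = toU₄ , into-U₄ , injective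
  where
  into-U₄ : (p : List ℕ) → P3 n p → U4 n (toU₄ p)
  into-U₄ p p∈P₃ = P3Shape⇒U4 (proj₁ (proj₁ p∈P₃)) (P3⇒P3Shape n≥4 p∈P₃)

  injective : (p q : List ℕ) → P3 n p → P3 n q → toU₄ p ≡ toU₄ q → p ≡ q
  injective p q p∈P₃ q∈P₃ same = begin
    p                ≡⟨ fromU₄∘toU₄ (P3⇒P3Shape n≥4 p∈P₃) ⟨
    fromU₄ (toU₄ p)  ≡⟨ cong fromU₄ same ⟩
    fromU₄ (toU₄ q)  ≡⟨ fromU₄∘toU₄ (P3⇒P3Shape n≥4 q∈P₃) ⟩
    q                ∎
    where open ≡-Reasoning
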